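{- For every finite simple graph $G$ there is an antipodal graph $G'$ obtained from $G$ by adding vertices and edges (so $V(G)\subseteq V(G')$ and $E(G)\subseteq E(G')$).
   Context: An antipode of a vertex $v$ of a connected graph is a vertex at maximum distance from $v$. A graph is antipodal if it is connected and every vertex has exactly one antipode. -}

module Defs where

open import Data.Nat using (ℕ; zero; suc; _≤_)
open import Data.Fin using (Fin)
open import Data.Bool using (Bool; true; false)
open import Data.Product using (Σ; ∃; _×_; _,_)
open import Function.Definitions using (Injective)
open import Relation.Binary.PropositionalEquality using (_≡_)

record Graph : Set where
  field
    n     : ℕ
    adj   : Fin n → Fin n → Bool
    sym   : ∀ u v → adj u v ≡ adj v u
    irrefl : ∀ v → adj v v ≡ false

open Graph public

data Walk (G : Graph) : Fin (n G) → Fin (n G) → ℕ → Set where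
  [] : ∀ {v} → Walk G v v zero
  step : ∀ {u w v k} → adj G u w ≡ true → Walk G w v k → Walk G u v (suc k)

IsDist : (G : Graph) → Fin (n G) → Fin (n G) → ℕ → Set
IsDist G u v d = Walk G u v d × (∀ k → Walk G u v k → d ≤ k)

Connected : Graph → Set
Connected G = ∀ u v → ∃ λ k → Walk G u v k

IsAntipode : (G : Graph) → Fin (n G) → Fin (n G) → Set
IsAntipode G v w =
  Σ ℕ λ d → IsDist G v w d × (∀ x e → IsDist G v x e → e ≤ d)

Antipodal : Graph → Set
Antipodal G =
  Connected G ×
  (∀ v → Σ (Fin (n G)) λ w → IsAntipode G v w × (∀ w′ → IsAntipode G v w′ → w′ ≡ w))

-- G′ is obtained from G by adding vertices and edges: an injective
-- vertex map (identifying V(G) with a subset of V(G′)) sending edges to edges.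
Supergraph : Graph → Graph → Set
Supergraph G G′ =
  Σ (Fin (n G) → Fin (n G′)) λ f →
    Injective _≡_ _≡_ f ×
    (∀ u v → adj G u v ≡ true → adj G′ (f u) (f v) ≡ true)

-- The cocktail party graph (complete multipartite with parts of size two, at
-- least two parts) has diameter 2, so the antipodes of a vertex are exactly its
-- non-neighbours other than itself, and each vertex has just one: the other
-- vertex of its part. Any graph embeds in it by placing its vertices in
-- distinct parts, since edges only join distinct vertices.
module Submission where

open import Defs hiding (sym)
open import Data.Bool using (Bool; true; false)
open import Data.Empty using (⊥-elim)
open import Data.Fin using (Fin; zero; suc; _↑ʳ_; combine; quotient; remainder; opposite; punchIn)
open import Data.Fin.Properties using (_≟_; ↑ʳ-injective; combine-remQuot; remQuot-combine; punchInᵢ≢i)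
open import Data.Nat using (ℕ; suc; _≤_; _*_; z≤n; s≤s)
open import Data.Nat.Properties using (≤-refl; ≤-trans; ≤-antisym)
open import Data.Product using (Σ; ∃; _×_; _,_; proj₁; proj₂)
open import Function.Definitions using (Injective)
open import Relation.Nullary using (yes; no)
open import Relation.Nullary.Decidable using (isNo)
open import Relation.Binary.PropositionalEquality using (_≡_; _≢_; refl; sym; trans; cong; cong₂; subst; ≢-sym; module ≡-Reasoning)

module _ {G : Graph} where

  walk₀⇒≡ : ∀ {u v} → Walk G u v 0 → u ≡ v
  walk₀⇒≡ [] = refl

  walk₁⇒adj : ∀ {u v} → Walk G u v 1 → adj G u v ≡ true
  walk₁⇒adj (step a []) = a

  adj⇒walk₁ : ∀ {u v} → adj G u v ≡ true → Walk G u v 1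
  adj⇒walk₁ a = step a []

  adj⇒≢ : ∀ {u v} → adj G u v ≡ true → u ≢ v
  adj⇒≢ {u} a refl with () ← trans (sym a) (irrefl G u)

HasDiameter≤ : Graph → ℕ → Set
HasDiameter≤ G d = ∀ u v → ∃ λ k → k ≤ d × Walk G u v k

NonNeighbour : (G : Graph) → Fin (n G) → Fin (n G) → Set
NonNeighbour G v w = v ≢ w × adj G v w ≡ false

module _ {G : Graph} {d : ℕ} (diam : HasDiameter≤ G d) where

  diameter⇒connected : Connected G
  diameter⇒connected u v with k , _ , p ← diam u v = k , p

  diameter⇒dist≤ : ∀ {u v e} → IsDist G u v e → e ≤ d
  diameter⇒dist≤ {u} {v} (_ , minimal) with k , k≤d , p ← diam u v = ≤-trans (minimal k p) k≤d

  diameter⇒isAntipode : ∀ {v w} → IsDist G v w d → IsAntipode G v w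
  diameter⇒isAntipode dist = _ , dist , λ _ _ → diameter⇒dist≤

isAntipode⇒walk-length≥ : ∀ {G v w x e} → IsDist G v x e → IsAntipode G v w →
                 ∀ k → Walk G v w k → e ≤ k
isAntipode⇒walk-length≥ {x = x} {e} distx (d , (_ , minimal) , maximal) k p =
  ≤-trans (maximal x e distx) (minimal k p)

nonNeighbour⇒2≤length : ∀ {G v w} → NonNeighbour G v w → ∀ k → Walk G v w k → 2 ≤ k
nonNeighbour⇒2≤length (v≢w , _) 0 p = ⊥-elim (v≢w (walk₀⇒≡ p))
nonNeighbour⇒2≤length (_ , ¬adj) 1 p with () ← trans (sym (walk₁⇒adj p)) ¬adj
nonNeighbour⇒2≤length _ (suc (suc _)) _ = s≤s (s≤s z≤n)

module _ {G : Graph} (diam : HasDiameter≤ G 2) where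

  nonNeighbour⇒isDist₂ : ∀ {v w} → NonNeighbour G v w → IsDist G v w 2
  nonNeighbour⇒isDist₂ {v} {w} nn with k , k≤2 , p ← diam v w =
    subst (Walk G v w) (≤-antisym k≤2 (2≤length k p)) p , 2≤length
    where
    2≤length : ∀ k → Walk G v w k → 2 ≤ k
    2≤length = nonNeighbour⇒2≤length nn

  nonNeighbour⇒isAntipode : ∀ {v w} → NonNeighbour G v w → IsAntipode G v w
  nonNeighbour⇒isAntipode nn = diameter⇒isAntipode diam (nonNeighbour⇒isDist₂ nn)

  isAntipode⇒nonNeighbour : ∀ {v w x} → NonNeighbour G v x → IsAntipode G v w → NonNeighbour G v w
  isAntipode⇒nonNeighbour {v} {w} nnx anti = v≢w , ¬adj
    where
    far : ∀ k → Walk G v w k → 2 ≤ k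
    far = isAntipode⇒walk-length≥ (nonNeighbour⇒isDist₂ nnx) anti

    v≢w : v ≢ w
    v≢w refl with () ← far 0 []

    ¬adj : adj G v w ≡ false
    ¬adj with adj G v w in a
    ... | false = refl
    ... | true with s≤s () ← far 1 (adj⇒walk₁ a)

  unique-nonNeighbour⇒antipodal :
    (∀ v → Σ (Fin (n G)) λ w → NonNeighbour G v w × (∀ w′ → NonNeighbour G v w′ → w′ ≡ w)) →
    Antipodal G
  unique-nonNeighbour⇒antipodal unique = diameter⇒connected diam , antipode
    where
    antipode : ∀ v → Σ (Fin (n G)) λ w → IsAntipode G v w × (∀ w′ → IsAntipode G v w′ → w′ ≡ w)
    antipode v with w , nn , only ← unique v =
      w , nonNeighbour⇒isAntipode nn , λ w′ anti → only w′ (isAntipode⇒nonNeighbour nn anti)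

module CompleteMultipartite {N m : ℕ} (part : Fin N → Fin m) where

  adjacent : Fin N → Fin N → Bool
  adjacent u v = isNo (part u ≟ part v)

  parts≢⇒adjacent : ∀ {u v} → part u ≢ part v → adjacent u v ≡ true
  parts≢⇒adjacent {u} {v} ne with part u ≟ part v
  ... | yes e = ⊥-elim (ne e)
  ... | no _ = refl

  parts≡⇒nonadjacent : ∀ {u v} → part u ≡ part v → adjacent u v ≡ false
  parts≡⇒nonadjacent {u} {v} e with part u ≟ part v
  ... | yes _ = refl
  ... | no ne = ⊥-elim (ne e)

  nonadjacent⇒parts≡ : ∀ {u v} → adjacent u v ≡ false → part u ≡ part v
  nonadjacent⇒parts≡ {u} {v} ¬adj with part u ≟ part v
  ... | yes e = e
  ... | no ne with () ← ¬adj

  adjacent-sym : ∀ u v → adjacent u v ≡ adjacent v u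
  adjacent-sym u v with part u ≟ part v
  ... | yes e = sym (parts≡⇒nonadjacent (sym e))
  ... | no ne = sym (parts≢⇒adjacent (≢-sym ne))

  completeMultipartite : Graph
  completeMultipartite = record
    { n = N ; adj = adjacent ; sym = adjacent-sym ; irrefl = λ _ → parts≡⇒nonadjacent refl }

  completeMultipartite-diameter≤2 :
    (∀ v → ∃ λ x → part v ≢ part x) → HasDiameter≤ completeMultipartite 2
  completeMultipartite-diameter≤2 elsewhere u v with part u ≟ part v
  ... | no ne = 1 , s≤s z≤n , adj⇒walk₁ (parts≢⇒adjacent ne)
  ... | yes u≈v with x , u≉x ← elsewhere u =
    2 , ≤-refl , step (parts≢⇒adjacent u≉x) (adj⇒walk₁ (parts≢⇒adjacent x≉v))
    where
    x≉v : part x ≢ part v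
    x≉v x≈v = u≉x (trans u≈v (sym x≈v))

  completeMultipartite-supergraph :
    (G : Graph) (ι : Fin (n G) → Fin N) → Injective _≡_ _≡_ (λ v → part (ι v)) →
    Supergraph G completeMultipartite
  completeMultipartite-supergraph G ι inj =
    ι , (λ e → inj (cong part e)) , λ u v a → parts≢⇒adjacent (λ e → adj⇒≢ {G} a (inj e))

opposite-≢ : (s : Fin 2) → opposite s ≢ s
opposite-≢ zero ()
opposite-≢ (suc zero) ()

≢⇒≡opposite : (s t : Fin 2) → s ≢ t → s ≡ opposite t
≢⇒≡opposite zero zero ne = ⊥-elim (ne refl)
≢⇒≡opposite zero (suc zero) _ = refl
≢⇒≡opposite (suc zero) zero _ = refl
≢⇒≡opposite (suc zero) (suc zero) ne = ⊥-elim (ne refl)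

-- The vertex combine p s of the cocktail party graph with 2 + k parts is
-- vertex s of part p; the parameter k keeps the number of parts at least two.
module CocktailParty (k : ℕ) where

  Vertex : Set
  Vertex = Fin (suc (suc k) * 2)

  vertex : Fin (suc (suc k)) → Fin 2 → Vertex
  vertex = combine

  part : Vertex → Fin (suc (suc k))
  part = quotient 2

  side : Vertex → Fin 2
  side = remainder {suc (suc k)} 2

  open CompleteMultipartite part public

  cocktailParty : Graph
  cocktailParty = completeMultipartite

  part-vertex : ∀ (p : Fin (suc (suc k))) (s : Fin 2) → part (vertex p s) ≡ p
  part-vertex p s = cong proj₁ (remQuot-combine p s)

  side-vertex : ∀ (p : Fin (suc (suc k))) (s : Fin 2) → side (vertex p s) ≡ s
  side-vertex p s = cong proj₂ (remQuot-combine p s)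

  vertex-part-side : ∀ v → vertex (part v) (side v) ≡ v
  vertex-part-side = combine-remQuot 2

  partner : Vertex → Vertex
  partner v = vertex (part v) (opposite (side v))

  partner-nonNeighbour : ∀ v → NonNeighbour cocktailParty v (partner v)
  partner-nonNeighbour v = v≢partner , parts≡⇒nonadjacent {v} {partner v} (sym (part-vertex (part v) _))
    where
    v≢partner : v ≢ partner v
    v≢partner e = opposite-≢ (side v) (trans (sym (side-vertex (part v) _)) (cong side (sym e)))

  nonNeighbour⇒partner : ∀ v w → NonNeighbour cocktailParty v w → w ≡ partner v
  nonNeighbour⇒partner v w (v≢w , ¬adj) = begin
    w                        ≡⟨ vertex-part-side w ⟨
    vertex (part w) (side w) ≡⟨ cong₂ vertex (sym same-part) (≢⇒≡opposite (side w) (side v) other-side) ⟩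
    partner v                ∎
    where
    open ≡-Reasoning

    same-part : part v ≡ part w
    same-part = nonadjacent⇒parts≡ {v} {w} ¬adj

    other-side : side w ≢ side v
    other-side e = v≢w (begin
      v                         ≡⟨ vertex-part-side v ⟨
      vertex (part v) (side v) ≡⟨ cong₂ vertex same-part (sym e) ⟩
      vertex (part w) (side w) ≡⟨ vertex-part-side w ⟩
      w                         ∎)

  cocktailParty-diameter≤2 : HasDiameter≤ cocktailParty 2
  cocktailParty-diameter≤2 = completeMultipartite-diameter≤2 λ v →
    vertex (punchIn (part v) zero) zero ,
    λ e → punchInᵢ≢i (part v) zero (sym (trans e (part-vertex _ zero)))

  cocktailParty-antipodal : Antipodal cocktailParty
  cocktailParty-antipodal = unique-nonNeighbour⇒antipodal cocktailParty-diameter≤2 λ v →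
    partner v , partner-nonNeighbour v , nonNeighbour⇒partner v

  cocktailParty-supergraph : (G : Graph) (ι : Fin (n G) → Fin (suc (suc k))) → Injective _≡_ _≡_ ι →
                             Supergraph G cocktailParty
  cocktailParty-supergraph G ι inj = completeMultipartite-supergraph G (λ v → vertex (ι v) zero)
    λ e → inj (trans (sym (part-vertex _ zero)) (trans e (part-vertex _ zero)))

proposition7 : (G : Graph) → Σ Graph λ G′ → Supergraph G G′ × Antipodal G′
proposition7 G =
  cocktailParty , cocktailParty-supergraph G (2 ↑ʳ_) (↑ʳ-injective 2 _ _) , cocktailParty-antipodal
  where open CocktailParty (n G)
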